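{- Let $W=\{n \in \mathbb{N}: \text{for every prime } p,\ p\mid n \Rightarrow p^2\mid n\}$ be the set of powerful numbers. There is $N_0$ such that for every $N\ge N_0$: if $a_0$ is a non-negative integer and $A=\{a_1, \ldots, a_d\}$ is a set of positive integers with $H(a_0; a_1, \ldots, a_d) \subset W \cap [1,N]$, then \[ d \leq 5(\log N)^2. \]
   Context: For integers $a_0\neq 0, a_1,\dots,a_d$, the Hilbert cube is $H(a_0;a_1,\dots,a_d)=\{a_0+\sum_{i=1}^d \varepsilon_i a_i : \varepsilon_i\in\{0,1\}\}$; for $a_0=0$ the empty sum is excluded: $H(0;a_1,\dots,a_d)=\{\sum_{i=1}^d \varepsilon_i a_i : \varepsilon_i\in\{0,1\},\ \sum_i \varepsilon_i>0\}$. $\log$ is the natural logarithm. -}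

module Defs where

open import Data.Nat using (ℕ; zero; suc; _+_; _*_; _≤_)
open import Data.Nat.Divisibility using (_∣_)
open import Data.Nat.Primality using (Prime)
open import Data.Fin using (Fin; zero; suc)
open import Data.Bool using (Bool; true; false; if_then_else_)
open import Data.Integer using (+_)
open import Data.Rational using (ℚ; 0ℚ; 1ℚ) renaming (_+_ to _+ℚ_; _*_ to _*ℚ_; _/_ to _/ℚ_; _≤_ to _≤ℚ_; _<_ to _<ℚ_)
open import Data.Product using (∃)

Powerful : ℕ → Set
Powerful n = ∀ p → Prime p → p ∣ n → p * p ∣ n

selSum : ∀ {d} → (Fin d → Bool) → (Fin d → ℕ) → ℕ
selSum {zero}  ε a = 0
selSum {suc d} ε a = (if ε zero then a zero else 0) + selSum (λ i → ε (suc i)) (λ i → a (suc i))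

NonEmptySel : ∀ {d} → (Fin d → Bool) → Set
NonEmptySel {d} ε = ∃ λ (i : Fin d) → ε i ≡ true
  where open import Relation.Binary.PropositionalEquality using (_≡_)

-- Admissible choices of ε for the Hilbert cube H(a₀; a₁,…,a_d):
-- all ε if a₀ ≠ 0, only non-empty ε if a₀ = 0.
Admissible : ∀ {d} → ℕ → (Fin d → Bool) → Set
Admissible zero    ε = NonEmptySel ε
Admissible (suc _) ε = Data.Unit.⊤
  where import Data.Unit

CubeSubset : ∀ {d} → ℕ → (Fin d → ℕ) → (ℕ → Set) → Set
CubeSubset a₀ a S = ∀ ε → Admissible a₀ ε → S (a₀ + selSum ε a)

PowerfulUpTo : ℕ → ℕ → Set
PowerfulUpTo N n = Powerful n × (1 ≤ n × n ≤ N)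
  where open import Data.Product using (_×_)

expTerm : ℚ → ℕ → ℚ
expTerm q zero    = 1ℚ
expTerm q (suc k) = expTerm q k *ℚ q *ℚ ((+ 1) /ℚ suc k)

expPartial : ℚ → ℕ → ℚ
expPartial q zero    = expTerm q zero
expPartial q (suc K) = expPartial q K +ℚ expTerm q (suc K)

-- d ≤ 5 (log N)², encoded without reals:
-- for every rational q ≥ 0 with 5 q² < d we have e^q ≤ N,
-- where e^q ≤ N is expressed as: every partial sum of the exponential series is ≤ N.
LogSqBound : ℕ → ℕ → Set
LogSqBound d N =
  ∀ (q : ℚ) → 0ℚ ≤ℚ q → ((+ 5) /ℚ 1) *ℚ q *ℚ q <ℚ ((+ d) /ℚ 1) →
  ∀ (K : ℕ) → expPartial q K ≤ℚ ((+ N) /ℚ 1)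

{-# OPTIONS --safe #-}
-- Fix a prime p. Every sum a₀ + Σ εᵢaᵢ is powerful, so if p divides it then so does p². Add the aᵢ
-- one at a time and follow the set R of residues mod p² of the sums formed so far, through the
-- potential: number of classes mod p met by R, plus number of classes met at least twice. Adding
-- an aᵢ prime to p raises the potential, for otherwise R would be closed under +aᵢ mod p², hence
-- everything, and would contain p. The class 0 mod p is met only by 0 mod p², so the potential
-- stays below 2p, and at most 2p − 2 of the aᵢ are prime to p. Hence for X < 2^r every prime
-- q ≤ X divides ∏ aᵢ ≤ N^d at least d − 2X times, while every j ≤ X divides the r-th power of
-- the product of the primes up to X; as a common multiple of 1, …, X is at least 2^(X−1)
-- (Leibniz's harmonic triangle), 2^((X−1)(d−2X)) ≤ N^(dr). With 2^t < q ≤ 2^(t+1), X = 4^t and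
-- r = 2t + 1 this is incompatible with 5q² < d and e^q > N once N is large.
module Submission where

open import Defs

module Counting where

  open import Data.Nat
  open import Data.Nat.Properties
  open import Data.Empty using (⊥-elim)
  open import Data.Sum using (inj₁; inj₂)
  open import Function using (_∘_)
  open import Relation.Binary.PropositionalEquality using (refl)
  open import Relation.Nullary using (¬_; yes; no)
  open import Relation.Unary using (Pred; Decidable)
  open import Level using (0ℓ)

  count : {P : Pred ℕ 0ℓ} → Decidable P → ℕ → ℕ
  count P? zero = 0
  count P? (suc n) with P? n
  ... | yes _ = suc (count P? n)
  ... | no  _ = count P? n

  module _ {P : Pred ℕ 0ℓ} (P? : Decidable P) where

    count≤n : ∀ n → count P? n ≤ n
    count≤n zero = z≤n
    count≤n (suc n) with P? n
    ... | yes _ = s≤s (count≤n n)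
    ... | no  _ = m≤n⇒m≤1+n (count≤n n)

    count<n : ∀ {n i} → i < n → ¬ P i → count P? n < n
    count<n {suc n} {i} i<1+n ¬Pi with P? n | m<1+n⇒m<n∨m≡n i<1+n
    ... | yes Pn | inj₂ refl = ⊥-elim (¬Pi Pn)
    ... | yes _  | inj₁ i<n  = s≤s (count<n i<n ¬Pi)
    ... | no  _  | inj₁ i<n  = m≤n⇒m≤1+n (count<n i<n ¬Pi)
    ... | no  _  | inj₂ refl = s≤s (count≤n n)

    count>0 : ∀ {n i} → i < n → P i → 0 < count P? n
    count>0 {suc n} {i} i<1+n Pi with P? n | m<1+n⇒m<n∨m≡n i<1+n
    ... | yes _ | _         = z<s
    ... | no ¬Pn | inj₂ refl = ⊥-elim (¬Pn Pi)
    ... | no  _  | inj₁ i<n  = count>0 i<n Pi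

  module _ {P Q : Pred ℕ 0ℓ} (P? : Decidable P) (Q? : Decidable Q) where

    count-mono : ∀ n → (∀ {i} → i < n → P i → Q i) → count P? n ≤ count Q? n
    count-mono zero    P⊆Q = z≤n
    count-mono (suc n) P⊆Q with P? n | Q? n
    ... | yes _  | yes _  = s≤s (count-mono n (P⊆Q ∘ m<n⇒m<1+n))
    ... | yes Pn | no ¬Qn = ⊥-elim (¬Qn (P⊆Q ≤-refl Pn))
    ... | no  _  | yes _  = m≤n⇒m≤1+n (count-mono n (P⊆Q ∘ m<n⇒m<1+n))
    ... | no  _  | no  _  = count-mono n (P⊆Q ∘ m<n⇒m<1+n)

    ⊆∧count≥⇒⊇ : ∀ n → (∀ {i} → i < n → P i → Q i) → count Q? n ≤ count P? n →
                     ∀ {i} → i < n → Q i → P i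
    ⊆∧count≥⇒⊇ (suc n) P⊆Q Q≤P {i} i<1+n Qi with P? n | Q? n | m<1+n⇒m<n∨m≡n i<1+n
    ... | yes Pn | _      | inj₂ refl = Pn
    ... | no  _  | no ¬Qn | inj₂ refl = ⊥-elim (¬Qn Qi)
    ... | yes _  | yes _  | inj₁ i<n  = ⊆∧count≥⇒⊇ n (P⊆Q ∘ m<n⇒m<1+n) (s≤s⁻¹ Q≤P) i<n Qi
    ... | no  _  | no  _  | inj₁ i<n  = ⊆∧count≥⇒⊇ n (P⊆Q ∘ m<n⇒m<1+n) Q≤P i<n Qi
    ... | yes Pn | no ¬Qn | _         = ⊥-elim (¬Qn (P⊆Q ≤-refl Pn))
    ... | no  _  | yes _  | _         = ⊥-elim (<⇒≱ Q≤P (count-mono n (P⊆Q ∘ m<n⇒m<1+n)))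

module Modular where

  open import Data.Nat
  open import Data.Nat.Properties
  open import Data.Nat.DivMod
  open import Data.Nat.Coprimality using (Coprime; coprime-Bézout)
  open import Data.Nat.GCD using (module Bézout)
  open import Data.Nat.Tactic.RingSolver using (solve-∀)
  open import Data.Product using (∃; _,_; proj₁; proj₂)
  open import Level using (0ℓ)
  open import Relation.Binary.PropositionalEquality
  open import Relation.Unary using (Pred)
  open ≡-Reasoning

  coprime⇒inverse : ∀ {u n} .{{_ : NonZero n}} → 1 < n → Coprime u n → ∃ λ J → (J * u) % n ≡ 1
  coprime⇒inverse {n = 1} (s≤s ()) _
  coprime⇒inverse {u} {n@(2+ k)} _ cop with coprime-Bézout cop
  ... | Bézout.+- x y 1+yn≡xu = x , (begin
    (x * u) % n       ≡⟨ cong (_% n) 1+yn≡xu ⟨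
    (1 + y * n) % n   ≡⟨ [m+kn]%n≡m%n 1 y n ⟩
    1                 ∎)
  ... | Bézout.-+ x y 1+xu≡yn = x * suc k , (begin
    (x * suc k * u) % n             ≡⟨ [m+n]%n≡m%n (x * suc k * u) n ⟨
    (x * suc k * u + n) % n         ≡⟨ cong (_% n) (expand x k u) ⟩
    (1 + suc k * (1 + x * u)) % n   ≡⟨ cong (λ v → (1 + suc k * v) % n) 1+xu≡yn ⟩
    (1 + suc k * (y * n)) % n       ≡⟨ cong (λ v → (1 + v) % n) (*-assoc (suc k) y n) ⟨
    (1 + suc k * y * n) % n         ≡⟨ [m+kn]%n≡m%n 1 (suc k * y) n ⟩
    1                               ∎)
    where
    expand : ∀ x k u → x * suc k * u + 2+ k ≡ 1 + suc k * (1 + x * u)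
    expand = solve-∀

  module _ (n : ℕ) .{{_ : NonZero n}} where

    [m+o]%n≡[m%n+o]%n : ∀ m o → (m + o) % n ≡ (m % n + o) % n
    [m+o]%n≡[m%n+o]%n m o = begin
      (m + o) % n               ≡⟨ %-distribˡ-+ m o n ⟩
      (m % n + o % n) % n       ≡⟨ cong (λ r → (r + o % n) % n) (m%n%n≡m%n m n) ⟨
      (m % n % n + o % n) % n   ≡⟨ %-distribˡ-+ (m % n) o n ⟨
      (m % n + o) % n           ∎

    [m+o]%n≡[m+o%n]%n : ∀ m o → (m + o) % n ≡ (m + o % n) % n
    [m+o]%n≡[m+o%n]%n m o = begin
      (m + o) % n       ≡⟨ cong (_% n) (+-comm m o) ⟩
      (o + m) % n       ≡⟨ [m+o]%n≡[m%n+o]%n o m ⟩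
      (o % n + m) % n   ≡⟨ cong (_% n) (+-comm (o % n) m) ⟩
      (m + o % n) % n   ∎

    [x+u+[n∸u%n]]%n≡x%n : ∀ x u → (x + u + (n ∸ u % n)) % n ≡ x % n
    [x+u+[n∸u%n]]%n≡x%n x u = begin
      (x + u + (n ∸ u % n)) % n                        ≡⟨ cong (λ v → (x + v + (n ∸ u % n)) % n) (m≡m%n+[m/n]*n u n) ⟩
      (x + (u % n + u / n * n) + (n ∸ u % n)) % n      ≡⟨ cong (_% n) (regroup x (u % n) (u / n * n) (n ∸ u % n)) ⟩
      (x + (u / n * n + (u % n + (n ∸ u % n)))) % n    ≡⟨ cong (λ v → (x + (u / n * n + v)) % n) (m+[n∸m]≡n (m%n≤n u n)) ⟩
      (x + (u / n * n + n)) % n                        ≡⟨ cong (λ v → (x + v) % n) (+-comm (u / n * n) n) ⟩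
      (x + suc (u / n) * n) % n                        ≡⟨ [m+kn]%n≡m%n x (suc (u / n)) n ⟩
      x % n                                            ∎
      where
      regroup : ∀ a b c e → a + (b + c) + e ≡ a + (c + (b + e))
      regroup = solve-∀

    %-+-cancelʳ : ∀ {x y} u → x < n → y < n → (x + u) % n ≡ (y + u) % n → x ≡ y
    %-+-cancelʳ {x} {y} u x<n y<n eq = begin
      x                                  ≡⟨ m<n⇒m%n≡m x<n ⟨
      x % n                              ≡⟨ [x+u+[n∸u%n]]%n≡x%n x u ⟨
      (x + u + (n ∸ u % n)) % n          ≡⟨ [m+o]%n≡[m%n+o]%n (x + u) (n ∸ u % n) ⟩
      ((x + u) % n + (n ∸ u % n)) % n    ≡⟨ cong (λ r → (r + (n ∸ u % n)) % n) eq ⟩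
      ((y + u) % n + (n ∸ u % n)) % n    ≡⟨ [m+o]%n≡[m%n+o]%n (y + u) (n ∸ u % n) ⟨
      (y + u + (n ∸ u % n)) % n          ≡⟨ [x+u+[n∸u%n]]%n≡x%n y u ⟩
      y % n                              ≡⟨ m<n⇒m%n≡m y<n ⟩
      y                                  ∎

    module _ {P : Pred ℕ 0ℓ} {u : ℕ} (1<n : 1 < n) (u⊥n : Coprime u n)
             (closed : ∀ {x} → x < n → P x → P ((x + u) % n)) where

      +-closed⇒full : ∀ {x₀} → x₀ < n → P x₀ → ∀ {y} → y < n → P y
      +-closed⇒full {x₀} x₀<n Px₀ {y} y<n = subst P reaches-y (iterate (t * u⁻¹))
        where
        iterate : ∀ j → P ((x₀ + j * u) % n)
        iterate zero    = subst P (sym (trans (cong (_% n) (+-identityʳ x₀)) (m<n⇒m%n≡m x₀<n))) Px₀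
        iterate (suc j) = subst P step (closed (m%n<n (x₀ + j * u) n) (iterate j))
          where
          step : ((x₀ + j * u) % n + u) % n ≡ (x₀ + suc j * u) % n
          step = begin
            ((x₀ + j * u) % n + u) % n   ≡⟨ [m+o]%n≡[m%n+o]%n (x₀ + j * u) u ⟨
            (x₀ + j * u + u) % n         ≡⟨ cong (_% n) (+-assoc x₀ (j * u) u) ⟩
            (x₀ + (j * u + u)) % n       ≡⟨ cong (λ v → (x₀ + v) % n) (+-comm (j * u) u) ⟩
            (x₀ + suc j * u) % n         ∎
        u⁻¹ : ℕ
        u⁻¹ = proj₁ (coprime⇒inverse 1<n u⊥n)
        u⁻¹*u%n≡1 : (u⁻¹ * u) % n ≡ 1
        u⁻¹*u%n≡1 = proj₂ (coprime⇒inverse 1<n u⊥n)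
        t : ℕ
        t = y + n ∸ x₀
        reaches-y : (x₀ + t * u⁻¹ * u) % n ≡ y
        reaches-y = begin
          (x₀ + t * u⁻¹ * u) % n                     ≡⟨ cong (λ v → (x₀ + v) % n) (*-assoc t u⁻¹ u) ⟩
          (x₀ + t * (u⁻¹ * u)) % n                   ≡⟨ [m+o]%n≡[m+o%n]%n x₀ (t * (u⁻¹ * u)) ⟩
          (x₀ + t * (u⁻¹ * u) % n) % n               ≡⟨ cong (λ v → (x₀ + v) % n) (%-distribˡ-* t (u⁻¹ * u) n) ⟩
          (x₀ + (t % n * ((u⁻¹ * u) % n)) % n) % n   ≡⟨ cong (λ v → (x₀ + (t % n * v) % n) % n) u⁻¹*u%n≡1 ⟩
          (x₀ + (t % n * 1) % n) % n                 ≡⟨ cong (λ v → (x₀ + v % n) % n) (*-identityʳ (t % n)) ⟩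
          (x₀ + t % n % n) % n                       ≡⟨ cong (λ v → (x₀ + v) % n) (m%n%n≡m%n t n) ⟩
          (x₀ + t % n) % n                           ≡⟨ [m+o]%n≡[m+o%n]%n x₀ t ⟨
          (x₀ + t) % n                               ≡⟨ cong (_% n) (m+[n∸m]≡n (≤-trans (<⇒≤ x₀<n) (m≤n+m n y))) ⟩
          (y + n) % n                                ≡⟨ [m+n]%n≡m%n y n ⟩
          y % n                                      ≡⟨ m<n⇒m%n≡m y<n ⟩
          y                                          ∎


module CoprimalityFacts where

  open import Data.Nat
  open import Data.Nat.Divisibility
  open import Data.Nat.Coprimality using (Coprime; coprime-divisor; coprime⇒gcd≡1)
  open import Data.Nat.LCM using (lcm; lcm-least; gcd*lcm)
  open import Data.Nat.Primality using (Prime; prime⇒irreducible)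
  open import Data.Nat.Properties using (*-identityˡ)
  open import Data.Empty using (⊥-elim)
  open import Data.Product using (_,_)
  open import Data.Sum using (inj₁; inj₂)
  open import Relation.Nullary using (¬_)
  open import Relation.Binary.PropositionalEquality

  coprime-*ʳ : ∀ {a b c} → Coprime a b → Coprime a c → Coprime a (b * c)
  coprime-*ʳ {a} {b} a⊥b a⊥c (d∣a , d∣bc) = a⊥c (d∣a , coprime-divisor d⊥b d∣bc)
    where
    d⊥b : Coprime _ b
    d⊥b (e∣d , e∣b) = a⊥b (∣-trans e∣d d∣a , e∣b)

  coprime-^ʳ : ∀ {a b} s → Coprime a b → Coprime a (b ^ s)
  coprime-^ʳ zero    a⊥b (d∣a , d∣1) = ∣1⇒≡1 d∣1
  coprime-^ʳ (suc s) a⊥b = coprime-*ʳ a⊥b (coprime-^ʳ s a⊥b)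

  prime∤⇒coprime : ∀ {p n} → Prime p → ¬ p ∣ n → Coprime p n
  prime∤⇒coprime p-prime p∤n (d∣p , d∣n) with prime⇒irreducible p-prime d∣p
  ... | inj₁ d≡1 = d≡1
  ... | inj₂ refl = ⊥-elim (p∤n d∣n)

  coprime∧∣∧∣⇒*∣ : ∀ {a b c} → Coprime a b → a ∣ c → b ∣ c → a * b ∣ c
  coprime∧∣∧∣⇒*∣ {a} {b} a⊥b a∣c b∣c = subst (_∣ _) lcm≡a*b (lcm-least a∣c b∣c)
    where
    lcm≡a*b : lcm a b ≡ a * b
    lcm≡a*b = trans (sym (*-identityˡ (lcm a b)))
                    (trans (cong (_* lcm a b) (sym (coprime⇒gcd≡1 a⊥b))) (gcd*lcm a b))

module SubsetSumResidues where

  open import Data.Nat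
  open import Data.Nat.Properties
  open import Data.Nat.DivMod
  open import Data.Nat.Divisibility
  open import Data.Nat.Coprimality using (Coprime) renaming (sym to coprime-sym)
  open import Data.Nat.Primality using (Prime; prime⇒nonZero; prime⇒nonTrivial)
  open import Data.Bool using (Bool; T; true; false)
  open import Data.Fin using (Fin; zero; suc)
  open import Data.Vec.Functional using (tail; _∷_)
  open import Data.Product using (∃; _×_; _,_)
  open import Data.Sum using (_⊎_; inj₁; inj₂)
  open import Data.Empty using (⊥; ⊥-elim)
  open import Function using (_∘_)
  open import Relation.Nullary using (¬_; yes; no)
  open import Relation.Nullary.Decidable using (⌊_⌋; toWitness; fromWitness; T?; _×-dec_; _⊎-dec_; ¬?)
  open import Relation.Unary using (Decidable)
  open import Relation.Binary.PropositionalEquality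
  open Counting
  open Modular
  open CoprimalityFacts

  multiplesOf : ℕ → ∀ {d} → (Fin d → ℕ) → ℕ
  multiplesOf p {zero}  a = 0
  multiplesOf p {suc d} a with p ∣? a zero
  ... | yes _ = suc (multiplesOf p (tail a))
  ... | no  _ = multiplesOf p (tail a)

  SquareDivisibleSums : ℕ → ℕ → ∀ {d} → (Fin d → ℕ) → Set
  SquareDivisibleSums p a₀ a = ∀ ε → p ∣ a₀ + selSum ε a → p * p ∣ a₀ + selSum ε a

  module _ {p : ℕ} (p-prime : Prime p) where

    p² : ℕ
    p² = p * p

    private instance
      p≢0  : NonZero p
      p≢0  = prime⇒nonZero p-prime
      p²≢0 : NonZero p²
      p²≢0 = m*n≢0 p p

    1<p : 1 < p
    1<p = nonTrivial⇒n>1 p {{prime⇒nonTrivial p-prime}}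

    p<p² : p < p²
    p<p² = m<m*n p p 1<p

    [x+u]%p²%p : ∀ x u → (x + u) % p² % p ≡ (x % p + u) % p
    [x+u]%p²%p x u = trans (m∣n⇒o%n%m≡o%m p p² (x + u) (m∣m*n p)) ([m+o]%n≡[m%n+o]%n p x u)

    -- A set of residues mod p² is a Boolean predicate on ℕ; only its values below p² matter.
    _⊆ᵇ_ : (ℕ → Bool) → (ℕ → Bool) → Set
    R ⊆ᵇ R′ = ∀ {x} → T (R x) → T (R′ x)

    Shift : ℕ → (ℕ → Bool) → ℕ → Set
    Shift u R x = T (R x) ⊎ ∃ λ y → y < p² × (T (R y) × (y + u) % p² ≡ x)

    shift : ℕ → (ℕ → Bool) → ℕ → Bool
    shift u R x = ⌊ T? (R x) ⊎-dec anyUpTo? (λ y → T? (R y) ×-dec ((y + u) % p² ≟ x)) p² ⌋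

    shift-⊇ : ∀ {u R} → R ⊆ᵇ shift u R
    shift-⊇ Rx = fromWitness (inj₁ Rx)

    shift-+ : ∀ {u R y} → y < p² → T (R y) → T (shift u R ((y + u) % p²))
    shift-+ y<p² Ry = fromWitness (inj₂ (_ , y<p² , Ry , refl))

    shift-elim : ∀ {u R x} → T (shift u R x) → Shift u R x
    shift-elim = toWitness

    InClass : (ℕ → Bool) → ℕ → ℕ → Set
    InClass R c x = T (R x) × x % p ≡ c

    HitsClass : (ℕ → Bool) → ℕ → Set
    HitsClass R c = ∃ λ x → x < p² × InClass R c x

    hitsClass? : ∀ R → Decidable (HitsClass R)
    hitsClass? R c = anyUpTo? (λ x → T? (R x) ×-dec (x % p ≟ c)) p²

    HitsClassTwice : (ℕ → Bool) → ℕ → Set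
    HitsClassTwice R c = ∃ λ x → x < p² × ∃ λ y → y < p² × (x ≢ y × InClass R c x × InClass R c y)

    hitsClassTwice? : ∀ R → Decidable (HitsClassTwice R)
    hitsClassTwice? R c = anyUpTo? (λ x → anyUpTo? (λ y →
      ¬? (x ≟ y) ×-dec (T? (R x) ×-dec (x % p ≟ c)) ×-dec (T? (R y) ×-dec (y % p ≟ c))) p²) p²

    potential : (ℕ → Bool) → ℕ
    potential R = count (hitsClass? R) p + count (hitsClassTwice? R) p

    ZeroClassTrivial : (ℕ → Bool) → Set
    ZeroClassTrivial R = ∀ {x} → x < p² → T (R x) → x % p ≡ 0 → x ≡ 0

    module _ {R R′ : ℕ → Bool} (R⊆R′ : R ⊆ᵇ R′) where

      hitsClass-mono : ∀ {c} → HitsClass R c → HitsClass R′ c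
      hitsClass-mono (x , x<p² , Rx , x≡c) = x , x<p² , R⊆R′ Rx , x≡c

      hitsClassTwice-mono : ∀ {c} → HitsClassTwice R c → HitsClassTwice R′ c
      hitsClassTwice-mono (x , x<p² , y , y<p² , x≢y , (Rx , x≡c) , (Ry , y≡c)) =
        x , x<p² , y , y<p² , x≢y , (R⊆R′ Rx , x≡c) , (R⊆R′ Ry , y≡c)

      count-hitsClass-mono : count (hitsClass? R) p ≤ count (hitsClass? R′) p
      count-hitsClass-mono = count-mono _ _ p (λ _ → hitsClass-mono)

      count-hitsClassTwice-mono : count (hitsClassTwice? R) p ≤ count (hitsClassTwice? R′) p
      count-hitsClassTwice-mono = count-mono _ _ p (λ _ → hitsClassTwice-mono)

      potential-mono : potential R ≤ potential R′
      potential-mono = +-mono-≤ count-hitsClass-mono count-hitsClassTwice-mono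

      zeroClassTrivial-anti : ZeroClassTrivial R′ → ZeroClassTrivial R
      zeroClassTrivial-anti triv x<p² Rx = triv x<p² (R⊆R′ Rx)

    module _ {u : ℕ} {R : ℕ → Bool} where

      hitsClass-shift : ∀ {c} → HitsClass R c → HitsClass (shift u R) ((c + u) % p)
      hitsClass-shift (x , x<p² , Rx , refl) =
        (x + u) % p² , m%n<n (x + u) p² , shift-+ x<p² Rx , [x+u]%p²%p x u

      hitsClassTwice-shift : ∀ {c} → HitsClassTwice R c → HitsClassTwice (shift u R) ((c + u) % p)
      hitsClassTwice-shift (x , x<p² , y , y<p² , x≢y , (Rx , refl) , (Ry , y≡c)) =
        (x + u) % p² , m%n<n (x + u) p² , (y + u) % p² , m%n<n (y + u) p² ,
        x≢y ∘ %-+-cancelʳ p² u x<p² y<p² ,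
        (shift-+ x<p² Rx , [x+u]%p²%p x u) ,
        (shift-+ y<p² Ry , trans ([x+u]%p²%p y u) (cong (λ c → (c + u) % p) y≡c))

    zeroClass-notTwice : ∀ {R} → ZeroClassTrivial R → ¬ HitsClassTwice R 0
    zeroClass-notTwice triv (x , x<p² , y , y<p² , x≢y , (Rx , x≡0) , (Ry , y≡0)) =
      x≢y (trans (triv x<p² Rx x≡0) (sym (triv y<p² Ry y≡0)))

    potential<2p : ∀ {R} → ZeroClassTrivial R → potential R < 2 * p
    potential<2p {R} triv = begin-strict
      potential R   <⟨ +-mono-≤-< (count≤n (hitsClass? R) p)
                                   (count<n (hitsClassTwice? R) (>-nonZero⁻¹ p) (zeroClass-notTwice triv)) ⟩
      p + p         ≡⟨ cong (p +_) (+-identityʳ p) ⟨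
      2 * p         ∎
      where open ≤-Reasoning

    module _ {u : ℕ} {R : ℕ → Bool} (p∤u : ¬ p ∣ u) (triv : ZeroClassTrivial (shift u R))
             {x₀ : ℕ} (x₀<p² : x₀ < p²) (Rx₀ : T (R x₀)) where

      private
        R′ : ℕ → Bool
        R′ = shift u R

        u⊥p : Coprime u p
        u⊥p = coprime-sym (prime∤⇒coprime p-prime p∤u)

        u⊥p² : Coprime u p²
        u⊥p² = coprime-*ʳ u⊥p u⊥p

        module Stable (stable : potential R′ ≤ potential R) where

          hitsClass-stable : ∀ {c} → c < p → HitsClass R′ c → HitsClass R c
          hitsClass-stable = ⊆∧count≥⇒⊇ (hitsClass? R) (hitsClass? R′) p (λ _ → hitsClass-mono shift-⊇)
            (+-cancelʳ-≤ _ _ _ (≤-trans stable (+-monoʳ-≤ _ (count-hitsClassTwice-mono shift-⊇))))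

          hitsClassTwice-stable : ∀ {c} → c < p → HitsClassTwice R′ c → HitsClassTwice R c
          hitsClassTwice-stable = ⊆∧count≥⇒⊇ (hitsClassTwice? R) (hitsClassTwice? R′) p (λ _ → hitsClassTwice-mono shift-⊇)
            (+-cancelˡ-≤ _ _ _ (≤-trans stable (+-monoˡ-≤ _ (count-hitsClass-mono shift-⊇))))

          hitsEveryClass : ∀ {c} → c < p → HitsClass R c
          hitsEveryClass = +-closed⇒full p {P = HitsClass R} 1<p u⊥p
            (λ _ → hitsClass-stable (m%n<n _ p) ∘ hitsClass-shift) (m%n<n x₀ p) (x₀ , x₀<p² , Rx₀ , refl)

          noClassTwice : ∀ {c} → c < p → ¬ HitsClassTwice R c
          noClassTwice c<p twice = zeroClass-notTwice (zeroClassTrivial-anti shift-⊇ triv)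
            (+-closed⇒full p {P = HitsClassTwice R} 1<p u⊥p
              (λ _ → hitsClassTwice-stable (m%n<n _ p) ∘ hitsClassTwice-shift) c<p twice (>-nonZero⁻¹ p))

          -- The class of x + u is met by some w ∈ R; w ≠ x + u would make that class met twice in R′.
          +u-closed : ∀ {x} → x < p² → T (R x) → T (R ((x + u) % p²))
          +u-closed {x} x<p² Rx with hitsEveryClass (m%n<n ((x + u) % p²) p)
          ... | w , w<p² , Rw , w≡[x+u] with w ≟ (x + u) % p²
          ...   | yes refl = Rw
          ...   | no  w≢x+u = ⊥-elim (noClassTwice (m%n<n _ p) (hitsClassTwice-stable (m%n<n _ p)
                    (w , w<p² , (x + u) % p² , m%n<n (x + u) p² , w≢x+u ,
                     (shift-⊇ Rw , w≡[x+u]) , (shift-+ x<p² Rx , refl))))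

          R-full : ∀ {y} → y < p² → T (R y)
          R-full = +-closed⇒full p² {P = T ∘ R} (<-trans 1<p p<p²) u⊥p² (λ x<p² → +u-closed x<p²) x₀<p² Rx₀

          -- p lies in R and in the class 0 mod p, but is not 0 mod p².
          impossible : ⊥
          impossible = ≢-nonZero⁻¹ p (zeroClassTrivial-anti shift-⊇ triv p<p² (R-full p<p²) (n%n≡0 p))

      potential-shift-< : potential R < potential R′
      potential-shift-< = ≰⇒> Stable.impossible

    module _ (a₀ : ℕ) where

      reachable : ∀ {d} → (Fin d → ℕ) → ℕ → Bool
      reachable {zero}  a x = ⌊ x ≟ a₀ % p² ⌋
      reachable {suc d} a   = shift (a zero) (reachable (tail a))

      reachable-a₀ : ∀ {d} (a : Fin d → ℕ) → T (reachable a (a₀ % p²))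
      reachable-a₀ {zero}  a = fromWitness refl
      reachable-a₀ {suc d} a = shift-⊇ (reachable-a₀ (tail a))

      reachable-sound : ∀ {d} (a : Fin d → ℕ) {x} → T (reachable a x) → ∃ λ ε → (a₀ + selSum ε a) % p² ≡ x
      reachable-sound {zero}  a r = (λ ()) , trans (cong (_% p²) (+-identityʳ a₀)) (sym (toWitness r))
      reachable-sound {suc d} a {x} r with shift-elim r
      ... | inj₁ r′ with reachable-sound (tail a) r′
      ...   | ε , sum≡x = (false ∷ ε) , sum≡x
      reachable-sound {suc d} a {x} r | inj₂ (y , _ , r′ , [y+a0]≡x) with reachable-sound (tail a) r′
      ...   | ε , sum≡y = (true ∷ ε) , (begin
        (a₀ + (a zero + s)) % p²       ≡⟨ cong (_% p²) (m+[n+o]≡m+o+n a₀ (a zero) s) ⟩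
        (a₀ + s + a zero) % p²         ≡⟨ [m+o]%n≡[m%n+o]%n p² (a₀ + s) (a zero) ⟩
        ((a₀ + s) % p² + a zero) % p²  ≡⟨ cong (λ v → (v + a zero) % p²) sum≡y ⟩
        (y + a zero) % p²              ≡⟨ [y+a0]≡x ⟩
        x                              ∎)
        where
        open ≡-Reasoning
        s : ℕ
        s = selSum ε (tail a)
        m+[n+o]≡m+o+n : ∀ m n o → m + (n + o) ≡ m + o + n
        m+[n+o]≡m+o+n m n o = trans (cong (m +_) (+-comm n o)) (sym (+-assoc m o n))

      zeroClassTrivial-reachable : ∀ {d} (a : Fin d → ℕ) → SquareDivisibleSums p a₀ a → ZeroClassTrivial (reachable a)
      zeroClassTrivial-reachable a p²∣sums x<p² r x≡0 with reachable-sound a r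
      ... | ε , refl = n∣m⇒m%n≡0 _ p² (p²∣sums ε (m%n≡0⇒n∣m _ p
              (trans (sym (m∣n⇒o%n%m≡o%m p p² (a₀ + selSum ε a) (m∣m*n p))) x≡0)))

      reachable-potential : ∀ {d} (a : Fin d → ℕ) → ZeroClassTrivial (reachable a) →
                            suc d ≤ multiplesOf p a + potential (reachable a)
      reachable-potential {zero} a triv =
        ≤-trans (count>0 (hitsClass? (reachable a)) (m%n<n (a₀ % p²) p) (a₀ % p² , m%n<n a₀ p² , reachable-a₀ a , refl))
                (m≤m+n _ _)
      reachable-potential {suc d} a triv with p ∣? a zero
      ... | yes _ = s≤s (≤-trans (reachable-potential (tail a) (zeroClassTrivial-anti shift-⊇ triv))
                                 (+-monoʳ-≤ (multiplesOf p (tail a)) (potential-mono {R = R} {R′ = reachable a} shift-⊇)))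
        where
        R : ℕ → Bool
        R = reachable (tail a)
      ... | no p∤a = begin
        2 + d                                   ≤⟨ s≤s (reachable-potential (tail a) (zeroClassTrivial-anti shift-⊇ triv)) ⟩
        suc (multiplesOf p (tail a) + potential R)  ≡⟨ +-suc _ _ ⟨
        multiplesOf p (tail a) + suc (potential R)  ≤⟨ +-monoʳ-≤ _ (potential-shift-< p∤a triv (m%n<n a₀ p²) (reachable-a₀ (tail a))) ⟩
        multiplesOf p (tail a) + potential (reachable a)  ∎
        where
        open ≤-Reasoning
        R : ℕ → Bool
        R = reachable (tail a)

  multiplesOf-bound : ∀ {p} → Prime p → ∀ a₀ {d} (a : Fin d → ℕ) →
                      SquareDivisibleSums p a₀ a → 2 + d ≤ multiplesOf p a + 2 * p
  multiplesOf-bound {p} p-prime a₀ {d} a p²∣sums = begin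
    2 + d                                        ≤⟨ s≤s (reachable-potential p-prime a₀ a triv) ⟩
    suc (multiplesOf p a + potential p-prime R)  ≡⟨ +-suc _ _ ⟨
    multiplesOf p a + suc (potential p-prime R)  ≤⟨ +-monoʳ-≤ _ (potential<2p p-prime triv) ⟩
    multiplesOf p a + 2 * p                      ∎
    where
    open ≤-Reasoning
    R : ℕ → Bool
    R = reachable p-prime a₀ a
    triv : ZeroClassTrivial p-prime R
    triv = zeroClassTrivial-reachable p-prime a₀ a p²∣sums

module CommonMultiples where

  open import Data.Nat
  open import Data.Nat.Properties
  open import Data.Nat.Divisibility
  open import Data.Nat.Combinatorics using (_C_; nC1≡n; k>n⇒nCk≡0; nCk+nC[k+1]≡[n+1]C[k+1])
  open import Data.Nat.Tactic.RingSolver using (solve-∀)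
  open import Function using (_∘_)
  open import Relation.Binary.PropositionalEquality

  CommonMultipleUpTo : ℕ → ℕ → Set
  CommonMultipleUpTo n L = ∀ {j} → 1 ≤ j → j ≤ n → j ∣ L

  pascal : ∀ n k → suc n C suc k ≡ n C k + n C suc k
  pascal n k = sym (nCk+nC[k+1]≡[n+1]C[k+1] n k)

  nCk>0 : ∀ {n k} → k ≤ n → 0 < n C k
  nCk>0 {k = zero}              _         = z<s
  nCk>0 {suc n} {suc k} (s≤s k≤n) = subst (0 <_) (sym (pascal n k)) (≤-trans (nCk>0 k≤n) (m≤m+n _ _))

  [n+1]*nCk>0 : ∀ n {k} → k ≤ n → 0 < suc n * (n C k)
  [n+1]*nCk>0 n k≤n = *-mono-< (z<s {n}) (nCk>0 k≤n)

  [k+1]*[n+1]C[k+1]≡[n+1]*nCk : ∀ n k → suc k * (suc n C suc k) ≡ suc n * (n C k)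
  [k+1]*[n+1]C[k+1]≡[n+1]*nCk n zero = trans (+-identityʳ _) (trans (nC1≡n (suc n)) (sym (*-identityʳ (suc n))))
  [k+1]*[n+1]C[k+1]≡[n+1]*nCk zero (suc k) = *-zeroʳ (2+ k)
  [k+1]*[n+1]C[k+1]≡[n+1]*nCk (suc n) (suc k) = begin
    2+ k * (2+ n C 2+ k)                                       ≡⟨ cong (2+ k *_) (pascal (suc n) (suc k)) ⟩
    2+ k * (suc n C suc k + suc n C 2+ k)                      ≡⟨ split k (suc n C suc k) (suc n C 2+ k) ⟩
    suc k * (suc n C suc k) + suc n C suc k + 2+ k * (suc n C 2+ k)
      ≡⟨ cong₂ (λ a b → a + suc n C suc k + b) ([k+1]*[n+1]C[k+1]≡[n+1]*nCk n k) ([k+1]*[n+1]C[k+1]≡[n+1]*nCk n (suc k)) ⟩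
    suc n * (n C k) + suc n C suc k + suc n * (n C suc k)      ≡⟨ merge n (n C k) (suc n C suc k) (n C suc k) ⟩
    suc n * (n C k + n C suc k) + suc n C suc k                ≡⟨ cong (λ c → suc n * c + suc n C suc k) (pascal n k) ⟨
    suc n * (suc n C suc k) + suc n C suc k                    ≡⟨ +-comm (suc n * (suc n C suc k)) _ ⟩
    2+ n * (suc n C suc k)                                     ∎
    where
    open ≡-Reasoning
    split : ∀ k a b → 2+ k * (a + b) ≡ suc k * a + a + 2+ k * b
    split = solve-∀
    merge : ∀ n a b c → suc n * a + b + suc n * c ≡ suc n * (a + c) + b
    merge = solve-∀

  binomialSum : ℕ → ℕ → ℕ
  binomialSum n zero    = 0
  binomialSum n (suc j) = binomialSum n j + n C j

  binomialSum-pascal : ∀ n j → binomialSum (suc n) (suc j) ≡ binomialSum n (suc j) + binomialSum n j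
  binomialSum-pascal n zero    = refl
  binomialSum-pascal n (suc j) = begin
    binomialSum (suc n) (suc j) + suc n C suc j                ≡⟨ cong₂ _+_ (binomialSum-pascal n j) (pascal n j) ⟩
    binomialSum n j + n C j + binomialSum n j + (n C j + n C suc j)  ≡⟨ regroup (binomialSum n j) (n C j) (n C suc j) ⟩
    binomialSum n j + n C j + n C suc j + (binomialSum n j + n C j)  ∎
    where
    open ≡-Reasoning
    regroup : ∀ s a b → s + a + s + (a + b) ≡ s + a + b + (s + a)
    regroup = solve-∀

  binomialSum-full : ∀ n → binomialSum n (suc n) ≡ 2 ^ n
  binomialSum-full zero    = refl
  binomialSum-full (suc n) = begin
    binomialSum (suc n) (2+ n)                               ≡⟨ binomialSum-pascal n (suc n) ⟩
    binomialSum n (suc n) + n C suc n + binomialSum n (suc n)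
      ≡⟨ cong (λ c → binomialSum n (suc n) + c + binomialSum n (suc n)) (k>n⇒nCk≡0 (n<1+n n)) ⟩
    binomialSum n (suc n) + 0 + binomialSum n (suc n)         ≡⟨ cong (λ s → s + 0 + s) (binomialSum-full n) ⟩
    2 ^ n + 0 + 2 ^ n                                        ≡⟨ cong (_+ 2 ^ n) (+-identityʳ (2 ^ n)) ⟩
    2 ^ n + 2 ^ n                                            ≡⟨ cong (2 ^ n +_) (+-identityʳ (2 ^ n)) ⟨
    2 ^ suc n                                                ∎
    where open ≡-Reasoning

  -- The hypothesis z * y ≡ x * y + z * x says 1/z = 1/x − 1/y; then L = z (L/x − L/y).
  ∣-harmonic : ∀ {x y z L} → 0 < x → 0 < y → 0 < z → z * y ≡ x * y + z * x → x ∣ L → y ∣ L → z ∣ L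
  ∣-harmonic {x} {y} {z} {L} x>0 y>0 z>0 zy≡xy+zx (divides α L≡αx) (divides β L≡βy) =
    divides (α ∸ β) (sym (trans (*-comm (α ∸ β) z) z[α∸β]≡L))
    where
    x≤y : x ≤ y
    x≤y = *-cancelˡ-≤ z {{>-nonZero z>0}} (subst (z * x ≤_) (trans (+-comm (z * x) (x * y)) (sym zy≡xy+zx)) (m≤m+n (z * x) (x * y)))
    β≤α : β ≤ α
    β≤α = *-cancelʳ-≤ β α y {{>-nonZero y>0}} (subst (_≤ α * y) (trans (sym L≡αx) L≡βy) (*-monoʳ-≤ α x≤y))
    α≡β+[α∸β] : α ≡ β + (α ∸ β)
    α≡β+[α∸β] = sym (m+[n∸m]≡n β≤α)
    key : z * (α ∸ β) * (x * y) + z * β * (x * y) ≡ L * (x * y) + z * β * (x * y)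
    key = begin
      z * (α ∸ β) * (x * y) + z * β * (x * y)  ≡⟨ factor z (α ∸ β) β x y ⟩
      z * ((β + (α ∸ β)) * x) * y              ≡⟨ cong (λ t → z * (t * x) * y) α≡β+[α∸β] ⟨
      z * (α * x) * y                          ≡⟨ cong (λ t → z * t * y) L≡αx ⟨
      z * L * y                                ≡⟨ rearrange z L y ⟩
      L * (z * y)                              ≡⟨ cong (L *_) zy≡xy+zx ⟩
      L * (x * y + z * x)                      ≡⟨ distribute L x y z ⟩
      L * (x * y) + z * x * L                  ≡⟨ cong (λ t → L * (x * y) + z * x * t) L≡βy ⟩
      L * (x * y) + z * x * (β * y)            ≡⟨ cong (L * (x * y) +_) (swap z x β y) ⟩
      L * (x * y) + z * β * (x * y)            ∎
      where
      open ≡-Reasoning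
      factor : ∀ z γ β x y → z * γ * (x * y) + z * β * (x * y) ≡ z * ((β + γ) * x) * y
      factor = solve-∀
      rearrange : ∀ z L y → z * L * y ≡ L * (z * y)
      rearrange = solve-∀
      distribute : ∀ L x y z → L * (x * y + z * x) ≡ L * (x * y) + z * x * L
      distribute = solve-∀
      swap : ∀ z x β y → z * x * (β * y) ≡ z * β * (x * y)
      swap = solve-∀
    z[α∸β]≡L : z * (α ∸ β) ≡ L
    z[α∸β]≡L = *-cancelʳ-≡ _ _ (x * y) {{>-nonZero (*-mono-< x>0 y>0)}} (+-cancelʳ-≡ _ _ _ key)

  [n+1]*nCk∣ : ∀ n {L} → CommonMultipleUpTo (suc n) L → ∀ {k} → k ≤ n → suc n * (n C k) ∣ L
  [n+1]*nCk∣ zero    {L} cm z≤n = 1∣ L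
  [n+1]*nCk∣ (suc n) {L} cm = row
    where
    row : ∀ {k} → k ≤ suc n → 2+ n * (suc n C k) ∣ L
    row {zero}  _         = subst (_∣ L) (sym (*-identityʳ (2+ n))) (cm (s≤s z≤n) ≤-refl)
    row {suc k} (s≤s k≤n) =
      ∣-harmonic ([n+1]*nCk>0 n k≤n) ([n+1]*nCk>0 (suc n) (m≤n⇒m≤1+n k≤n)) ([n+1]*nCk>0 (suc n) (s≤s k≤n))
        leibniz ([n+1]*nCk∣ n (λ 1≤j → cm 1≤j ∘ m≤n⇒m≤1+n) k≤n) (row (m≤n⇒m≤1+n k≤n))
      where
      open ≡-Reasoning
      -- Leibniz's harmonic triangle: 1/((n+2)·C(n+1,k+1)) = 1/((n+1)·C(n,k)) − 1/((n+2)·C(n+1,k)).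
      leibniz : 2+ n * (suc n C suc k) * (2+ n * (suc n C k)) ≡ suc n * (n C k) * (2+ n * (suc n C k)) + 2+ n * (suc n C suc k) * (suc n * (n C k))
      leibniz = begin
        2+ n * c₂ * (2+ n * c₁)                   ≡⟨ cong (2+ n * c₂ *_) ([k+1]*[n+1]C[k+1]≡[n+1]*nCk (suc n) k) ⟨
        2+ n * c₂ * (suc k * (2+ n C suc k))      ≡⟨ cong (λ c → 2+ n * c₂ * (suc k * c)) (pascal (suc n) k) ⟩
        2+ n * c₂ * (suc k * (c₁ + c₂))           ≡⟨ expand n k c₁ c₂ ⟩
        suc k * c₂ * (2+ n * c₁) + 2+ n * c₂ * (suc k * c₂)
          ≡⟨ cong₂ (λ a b → a * (2+ n * c₁) + 2+ n * c₂ * b) [n+1]*nCk≡[k+1]*c₂ [n+1]*nCk≡[k+1]*c₂ ⟨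
        suc n * (n C k) * (2+ n * c₁) + 2+ n * c₂ * (suc n * (n C k))  ∎
        where
        c₁ c₂ : ℕ
        c₁ = suc n C k
        c₂ = suc n C suc k
        [n+1]*nCk≡[k+1]*c₂ : suc n * (n C k) ≡ suc k * c₂
        [n+1]*nCk≡[k+1]*c₂ = sym ([k+1]*[n+1]C[k+1]≡[n+1]*nCk n k)
        expand : ∀ n k a b → 2+ n * b * (suc k * (a + b)) ≡ suc k * b * (2+ n * a) + 2+ n * b * (suc k * b)
        expand = solve-∀

  2^n≤commonMultiple : ∀ n {L} → 0 < L → CommonMultipleUpTo (suc n) L → 2 ^ n ≤ L
  2^n≤commonMultiple n {L} L>0 cm =
    *-cancelˡ-≤ (suc n) (subst (λ s → suc n * s ≤ suc n * L) (binomialSum-full n) (partial (suc n) ≤-refl))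
    where
    partial : ∀ j → j ≤ suc n → suc n * binomialSum n j ≤ j * L
    partial zero    _         = ≤-reflexive (*-zeroʳ (suc n))
    partial (suc j) (s≤s j≤n) = begin
      suc n * (binomialSum n j + n C j)          ≡⟨ *-distribˡ-+ (suc n) (binomialSum n j) (n C j) ⟩
      suc n * binomialSum n j + suc n * (n C j)  ≤⟨ +-mono-≤ (partial j (m≤n⇒m≤1+n j≤n)) (∣⇒≤ {{>-nonZero L>0}} ([n+1]*nCk∣ n cm j≤n)) ⟩
      j * L + L                                  ≡⟨ +-comm (j * L) L ⟩
      suc j * L                                  ∎
      where open ≤-Reasoning

module Primorial where

  open import Data.Nat
  open import Data.Nat.Properties
  open import Data.Nat.Divisibility
  open import Data.Nat.Coprimality using (Coprime) renaming (sym to coprime-sym)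
  open import Data.Nat.Primality using (Prime; prime?; euclidsLemma; prime⇒nonTrivial; prime⇒nonZero; productOfPrimes≢0)
  open import Data.Nat.Primality.Factorisation using (factorise; PrimeFactorisation)
  open import Data.Nat.ListAction using (product)
  open import Data.Nat.Tactic.RingSolver using (solve-∀)
  open import Data.List using ([]; _∷_; length)
  open import Data.List.Relation.Unary.All using (All; []; _∷_)
  open import Data.Empty using (⊥-elim)
  open import Data.Sum using (inj₁; inj₂)
  open import Relation.Nullary using (¬_; yes; no)
  open import Relation.Binary.PropositionalEquality
  open CoprimalityFacts
  open CommonMultiples

  primorial : ℕ → ℕ
  primorial zero    = 1
  primorial (suc n) with prime? (suc n)
  ... | yes _ = suc n * primorial n
  ... | no  _ = primorial n

  prime>1 : ∀ {q} → Prime q → 1 < q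
  prime>1 {q} q-prime = nonTrivial⇒n>1 q {{prime⇒nonTrivial q-prime}}

  primorial>0 : ∀ n → 0 < primorial n
  primorial>0 zero    = z<s
  primorial>0 (suc n) with prime? (suc n)
  ... | yes _ = *-mono-< (z<s {n}) (primorial>0 n)
  ... | no  _ = primorial>0 n

  prime∣primorial : ∀ {q n} → Prime q → q ≤ n → q ∣ primorial n
  prime∣primorial {q} {zero}  q-prime q≤0 = ⊥-elim (<⇒≱ (prime>1 q-prime) (≤-trans q≤0 z≤n))
  prime∣primorial {q} {suc n} q-prime q≤1+n with prime? (suc n) | m≤n⇒m<n∨m≡n q≤1+n
  ... | yes _ | inj₂ refl = m∣m*n (primorial n)
  ... | no ¬p | inj₂ refl = ⊥-elim (¬p q-prime)
  ... | yes _ | inj₁ q<1+n = ∣-trans (prime∣primorial q-prime (s≤s⁻¹ q<1+n)) (n∣m*n (suc n))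
  ... | no  _ | inj₁ q<1+n = prime∣primorial q-prime (s≤s⁻¹ q<1+n)

  prime∤primorial : ∀ {q n} → Prime q → n < q → ¬ q ∣ primorial n
  prime∤primorial {q} {zero}  q-prime _ q∣1 = <⇒≢ (prime>1 q-prime) (sym (∣1⇒≡1 q∣1))
  prime∤primorial {q} {suc n} q-prime n<q q∣P with prime? (suc n)
  ... | no  _ = prime∤primorial q-prime (<-trans (n<1+n n) n<q) q∣P
  ... | yes _ with euclidsLemma (suc n) (primorial n) q-prime q∣P
  ...   | inj₁ q∣1+n = <⇒≱ n<q (∣⇒≤ q∣1+n)
  ...   | inj₂ q∣P′  = prime∤primorial q-prime (<-trans (n<1+n n) n<q) q∣P′

  [m*n]^s≡m^s*n^s : ∀ m n s → (m * n) ^ s ≡ m ^ s * n ^ s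
  [m*n]^s≡m^s*n^s m n zero    = refl
  [m*n]^s≡m^s*n^s m n (suc s) = trans (cong (m * n *_) ([m*n]^s≡m^s*n^s m n s)) (interchange m n (m ^ s) (n ^ s))
    where
    interchange : ∀ a b c d → a * b * (c * d) ≡ a * c * (b * d)
    interchange = solve-∀

  m^n∣m^o : ∀ m {n o} → n ≤ o → m ^ n ∣ m ^ o
  m^n∣m^o m {n} {o} n≤o = divides (m ^ (o ∸ n)) (trans (cong (m ^_) (sym (m∸n+n≡m n≤o))) (^-distribˡ-+-* m (o ∸ n) n))

  primorial^s∣ : ∀ n {s M} → (∀ {q} → Prime q → q ≤ n → q ^ s ∣ M) → primorial n ^ s ∣ M
  primorial^s∣ zero    {s} {M} _ = subst (_∣ M) (sym (^-zeroˡ s)) (1∣ M)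
  primorial^s∣ (suc n) {s} {M} q^s∣M with prime? (suc n)
  ... | yes n+1-prime = subst (_∣ M) (sym ([m*n]^s≡m^s*n^s (suc n) (primorial n) s))
          (coprime∧∣∧∣⇒*∣ powers-coprime (q^s∣M n+1-prime ≤-refl) rest)
    where
    rest : primorial n ^ s ∣ M
    rest = primorial^s∣ n {s} (λ q-prime q≤n → q^s∣M q-prime (m≤n⇒m≤1+n q≤n))
    powers-coprime : Coprime (suc n ^ s) (primorial n ^ s)
    powers-coprime = coprime-sym (coprime-^ʳ s (coprime-sym (coprime-^ʳ s
                       (prime∤⇒coprime n+1-prime (prime∤primorial n+1-prime ≤-refl)))))
  ... | no _ = primorial^s∣ n {s} (λ q-prime q≤n → q^s∣M q-prime (m≤n⇒m≤1+n q≤n))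

  2^m<2^n⇒m<n : ∀ {m n} → 2 ^ m < 2 ^ n → m < n
  2^m<2^n⇒m<n 2^m<2^n = ≰⇒> (λ n≤m → <⇒≱ 2^m<2^n (^-monoʳ-≤ 2 n≤m))

  2^length≤product : ∀ {qs} → All Prime qs → 2 ^ length qs ≤ product qs
  2^length≤product []                  = ≤-refl
  2^length≤product (q-prime ∷ qs-prime) = *-mono-≤ (prime>1 q-prime) (2^length≤product qs-prime)

  product∣primorial^length : ∀ {n qs} → All Prime qs → product qs ≤ n → product qs ∣ primorial n ^ length qs
  product∣primorial^length []                              _  = ∣-refl
  product∣primorial^length {n} {q ∷ qs} (q-prime ∷ qs-prime) ∏≤n =
    *-pres-∣ (prime∣primorial q-prime (≤-trans (m≤m*n q (product qs)) ∏≤n))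
             (product∣primorial^length qs-prime (≤-trans (m≤n*m (product qs) q) ∏≤n))
    where instance
      _ = productOfPrimes≢0 qs-prime
      _ = prime⇒nonZero q-prime

  commonMultiple-primorial^r : ∀ {n r} → n < 2 ^ r → CommonMultipleUpTo n (primorial n ^ r)
  commonMultiple-primorial^r {n} {r} n<2^r {j} 1≤j j≤n =
    subst (_∣ primorial n ^ r) (sym j≡∏qs)
      (∣-trans (product∣primorial^length qs-prime (subst (_≤ n) j≡∏qs j≤n)) (m^n∣m^o (primorial n) length≤r))
    where
    open PrimeFactorisation (factorise j {{>-nonZero 1≤j}})
      renaming (factors to qs; factorsPrime to qs-prime; isFactorisation to j≡∏qs)
    length≤r : length qs ≤ r
    length≤r = <⇒≤ (2^m<2^n⇒m<n (≤-<-trans (2^length≤product qs-prime)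
                                (subst (_< 2 ^ r) j≡∏qs (≤-<-trans j≤n n<2^r))))

  2^[[X∸1]*s]≤M^r : ∀ {X r s M} → 1 ≤ X → X < 2 ^ r → 0 < M →
                    (∀ {q} → Prime q → q ≤ X → q ^ s ∣ M) → 2 ^ ((X ∸ 1) * s) ≤ M ^ r
  2^[[X∸1]*s]≤M^r {suc Y} {r} {s} {M} _ X<2^r M>0 q^s∣M = begin
    2 ^ (Y * s)                ≡⟨ ^-*-assoc 2 Y s ⟨
    (2 ^ Y) ^ s                ≤⟨ ^-monoˡ-≤ s (2^n≤commonMultiple Y P^r>0 (commonMultiple-primorial^r {r = r} X<2^r)) ⟩
    (P ^ r) ^ s                ≡⟨ ^-*-assoc P r s ⟩
    P ^ (r * s)                ≡⟨ cong (P ^_) (*-comm r s) ⟩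
    P ^ (s * r)                ≡⟨ ^-*-assoc P s r ⟨
    (P ^ s) ^ r                ≤⟨ ^-monoˡ-≤ r (∣⇒≤ {{>-nonZero M>0}} (primorial^s∣ (suc Y) {s} q^s∣M)) ⟩
    M ^ r                      ∎
    where
    open ≤-Reasoning
    P : ℕ
    P = primorial (suc Y)
    P^r>0 : 0 < P ^ r
    P^r>0 = m^n>0 P {{>-nonZero (primorial>0 (suc Y))}} r

module PowerfulCubes where

  open import Data.Nat
  open import Data.Nat.Properties
  open import Data.Nat.Divisibility
  open import Data.Nat.Primality using (Prime)
  open import Data.Bool using (Bool; true; false)
  open import Data.Fin using (Fin; zero; suc)
  open import Data.Vec.Functional using (foldr; tail)
  open import Data.Product using (_,_; proj₁; proj₂)
  open import Data.Sum using (_⊎_; inj₁; inj₂)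
  open import Data.Unit using (tt)
  open import Relation.Nullary using (yes; no)
  open import Function using (_∘_)
  open import Relation.Binary.PropositionalEquality
  open SubsetSumResidues using (multiplesOf; SquareDivisibleSums; multiplesOf-bound)
  open Primorial using (m^n∣m^o; 2^[[X∸1]*s]≤M^r)

  product : ∀ {d} → (Fin d → ℕ) → ℕ
  product = foldr _*_ 1

  product>0 : ∀ {d} (a : Fin d → ℕ) → (∀ i → 0 < a i) → 0 < product a
  product>0 {zero}  a _   = z<s
  product>0 {suc d} a a>0 = *-mono-< (a>0 zero) (product>0 (tail a) (a>0 ∘ suc))

  product≤N^d : ∀ {N d} (a : Fin d → ℕ) → (∀ i → a i ≤ N) → product a ≤ N ^ d
  product≤N^d {d = zero}  a _   = ≤-refl
  product≤N^d {d = suc d} a a≤N = *-mono-≤ (a≤N zero) (product≤N^d (tail a) (λ i → a≤N (suc i)))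

  p^multiplesOf∣product : ∀ p {d} (a : Fin d → ℕ) → p ^ multiplesOf p a ∣ product a
  p^multiplesOf∣product p {zero}  a = ∣-refl
  p^multiplesOf∣product p {suc d} a with p ∣? a zero
  ... | yes p∣a₀ = *-pres-∣ p∣a₀ (p^multiplesOf∣product p (tail a))
  ... | no  _    = ∣-trans (p^multiplesOf∣product p (tail a)) (n∣m*n (a zero))

  indicator : ∀ {d} → Fin d → Fin d → Bool
  indicator zero    zero    = true
  indicator zero    (suc j) = false
  indicator (suc i) zero    = false
  indicator (suc i) (suc j) = indicator i j

  selSum-none : ∀ {d} (a : Fin d → ℕ) → selSum (λ _ → false) a ≡ 0
  selSum-none {zero}  a = refl
  selSum-none {suc d} a = selSum-none (tail a)

  selSum-indicator : ∀ {d} (i : Fin d) (a : Fin d → ℕ) → selSum (indicator i) a ≡ a i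
  selSum-indicator zero    a = trans (cong (a zero +_) (selSum-none (tail a))) (+-identityʳ (a zero))
  selSum-indicator (suc i) a = selSum-indicator i (tail a)

  indicator-nonEmpty : ∀ {d} (i : Fin d) → NonEmptySel (indicator i)
  indicator-nonEmpty zero    = zero , refl
  indicator-nonEmpty (suc i) with indicator-nonEmpty i
  ... | j , eq = suc j , eq

  nonEmpty⊎selSum≡0 : ∀ {d} (ε : Fin d → Bool) (a : Fin d → ℕ) → NonEmptySel ε ⊎ selSum ε a ≡ 0
  nonEmpty⊎selSum≡0 {zero}  ε a = inj₂ refl
  nonEmpty⊎selSum≡0 {suc d} ε a with ε zero in ε₀≡true
  ... | true  = inj₁ (zero , ε₀≡true)
  ... | false with nonEmpty⊎selSum≡0 (tail ε) (tail a)
  ...   | inj₁ (i , εi≡true) = inj₁ (suc i , εi≡true)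
  ...   | inj₂ sum≡0         = inj₂ sum≡0

  indicator-admissible : ∀ a₀ {d} (i : Fin d) → Admissible a₀ (indicator i)
  indicator-admissible zero    i = indicator-nonEmpty i
  indicator-admissible (suc _) i = tt

  cube-element≤N : ∀ {N a₀ d} {a : Fin d → ℕ} → CubeSubset a₀ a (PowerfulUpTo N) → ∀ i → a i ≤ N
  cube-element≤N {N} {a₀} {a = a} cube i = ≤-trans (m≤n+m (a i) a₀)
    (subst (λ s → a₀ + s ≤ N) (selSum-indicator i a) (proj₂ (proj₂ (cube (indicator i) (indicator-admissible a₀ i)))))

  -- For a₀ = 0 the empty selection lies outside the cube, but its sum 0 is divisible by p².
  cube-squareDivisibleSums : ∀ {N a₀ d} {a : Fin d → ℕ} → CubeSubset a₀ a (PowerfulUpTo N) →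
                             ∀ {p} → Prime p → SquareDivisibleSums p a₀ a
  cube-squareDivisibleSums {a₀ = suc _} cube p-prime ε = proj₁ (cube ε tt) _ p-prime
  cube-squareDivisibleSums {a₀ = zero} {a = a} cube {p} p-prime ε with nonEmpty⊎selSum≡0 ε a
  ... | inj₁ nonEmpty = proj₁ (cube ε nonEmpty) p p-prime
  ... | inj₂ sum≡0    = λ _ → subst (p * p ∣_) (sym sum≡0) ((p * p) ∣0)

  DimensionInequality : ℕ → ℕ → Set
  DimensionInequality d N = ∀ X r → 1 ≤ X → X < 2 ^ r → 2 ^ ((X ∸ 1) * (d ∸ 2 * X)) ≤ (N ^ d) ^ r

  cube⇒dimensionInequality : ∀ {N a₀ d} {a : Fin d → ℕ} → (∀ i → 0 < a i) →
                             CubeSubset a₀ a (PowerfulUpTo N) → DimensionInequality d N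
  cube⇒dimensionInequality {N} {a₀} {d} {a} a>0 cube X r 1≤X X<2^r =
    ≤-trans (2^[[X∸1]*s]≤M^r {r = r} 1≤X X<2^r (product>0 a a>0) q^[d∸2X]∣∏a)
            (^-monoˡ-≤ r (product≤N^d a (cube-element≤N cube)))
    where
    q^[d∸2X]∣∏a : ∀ {q} → Prime q → q ≤ X → q ^ (d ∸ 2 * X) ∣ product a
    q^[d∸2X]∣∏a {q} q-prime q≤X = ∣-trans (m^n∣m^o q d∸2X≤multiples) (p^multiplesOf∣product q a)
      where
      d∸2X≤multiples : d ∸ 2 * X ≤ multiplesOf q a
      d∸2X≤multiples = m≤n+o⇒m∸n≤o d (2 * X) (begin
        d                        ≤⟨ m≤n+m d 2 ⟩
        2 + d                    ≤⟨ multiplesOf-bound q-prime a₀ a (cube-squareDivisibleSums cube q-prime) ⟩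
        multiplesOf q a + 2 * q  ≤⟨ +-monoʳ-≤ (multiplesOf q a) (*-monoʳ-≤ 2 q≤X) ⟩
        multiplesOf q a + 2 * X  ≡⟨ +-comm (multiplesOf q a) (2 * X) ⟩
        2 * X + multiplesOf q a  ∎)
        where open ≤-Reasoning

module NaturalRationals where

  open import Data.Nat as ℕ using (ℕ; suc)
  import Data.Nat.Properties as ℕ
  open import Data.Integer as ℤ using (+_)
  import Data.Integer.Properties as ℤ
  open import Data.Nat.Coprimality using (1-coprimeTo) renaming (sym to coprime-sym)
  open import Data.Rational
  open import Data.Rational.Properties
  open import Relation.Binary.PropositionalEquality

  fromℕ : ℕ → ℚ
  fromℕ n = + n / 1

  fromℕ≡mkℚ : ∀ n → fromℕ n ≡ mkℚ (+ n) 0 (coprime-sym (1-coprimeTo n))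
  fromℕ≡mkℚ n = ↥p/↧p≡p (mkℚ (+ n) 0 (coprime-sym (1-coprimeTo n)))

  fromℕ-+ : ∀ m n → fromℕ m + fromℕ n ≡ fromℕ (m ℕ.+ n)
  fromℕ-+ m n rewrite fromℕ≡mkℚ m | fromℕ≡mkℚ n =
    /-cong {p₁ = + m ℤ.* + 1 ℤ.+ + n ℤ.* + 1} {q₁ = 1} (cong₂ ℤ._+_ (ℤ.*-identityʳ (+ m)) (ℤ.*-identityʳ (+ n))) refl

  fromℕ-* : ∀ m n → fromℕ m * fromℕ n ≡ fromℕ (m ℕ.* n)
  fromℕ-* m n rewrite fromℕ≡mkℚ m | fromℕ≡mkℚ n = /-cong {p₁ = + m ℤ.* + n} {q₁ = 1} (sym (ℤ.pos-* m n)) refl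

  fromℕ-mono-≤ : ∀ {m n} → m ℕ.≤ n → fromℕ m ≤ fromℕ n
  fromℕ-mono-≤ {m} {n} m≤n rewrite fromℕ≡mkℚ m | fromℕ≡mkℚ n =
    *≤* (subst₂ ℤ._≤_ (sym (ℤ.*-identityʳ (+ m))) (sym (ℤ.*-identityʳ (+ n))) (ℤ.+≤+ m≤n))

  fromℕ-mono-< : ∀ {m n} → m ℕ.< n → fromℕ m < fromℕ n
  fromℕ-mono-< {m} {n} m<n rewrite fromℕ≡mkℚ m | fromℕ≡mkℚ n =
    *<* (subst₂ ℤ._<_ (sym (ℤ.*-identityʳ (+ m))) (sym (ℤ.*-identityʳ (+ n))) (ℤ.+<+ m<n))

  fromℕ-cancel-< : ∀ {m n} → fromℕ m < fromℕ n → m ℕ.< n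
  fromℕ-cancel-< {m} {n} m<n rewrite fromℕ≡mkℚ m | fromℕ≡mkℚ n with m<n
  ... | *<* lt with subst₂ ℤ._<_ (ℤ.*-identityʳ (+ m)) (ℤ.*-identityʳ (+ n)) lt
  ...   | ℤ.+<+ m<n′ = m<n′

  fromℕ-nonNeg : ∀ n → 0ℚ ≤ fromℕ n
  fromℕ-nonNeg n = fromℕ-mono-≤ {0} {n} ℕ.z≤n

  1/[1+k] : ℕ → ℚ
  1/[1+k] k = + 1 / suc k

  1/[1+k]*[1+k]≡1 : ∀ k → 1/[1+k] k * fromℕ (suc k) ≡ 1ℚ
  1/[1+k]*[1+k]≡1 k = trans (cong₂ _*_ (↥p/↧p≡p (mkℚ (+ 1) k (1-coprimeTo (suc k)))) (fromℕ≡mkℚ (suc k)))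
                            (*-inverseˡ (mkℚ (+ suc k) 0 (coprime-sym (1-coprimeTo (suc k)))))

  1/[1+k]-nonNeg : ∀ k → 0ℚ ≤ 1/[1+k] k
  1/[1+k]-nonNeg k = nonNegative⁻¹ (1/[1+k] k) {{normalize-nonNeg 1 (suc k)}}

  *-monoʳ-≤-0≤ : ∀ {a b} c → 0ℚ ≤ c → a ≤ b → a * c ≤ b * c
  *-monoʳ-≤-0≤ c 0≤c = *-monoʳ-≤-nonNeg c {{nonNegative 0≤c}}

  *-monoˡ-≤-0≤ : ∀ {a b} c → 0ℚ ≤ c → a ≤ b → c * a ≤ c * b
  *-monoˡ-≤-0≤ c 0≤c = *-monoˡ-≤-nonNeg c {{nonNegative 0≤c}}

  *-0≤ : ∀ {a b} → 0ℚ ≤ a → 0ℚ ≤ b → 0ℚ ≤ a * b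
  *-0≤ {a} {b} 0≤a 0≤b = nonNegative⁻¹ _ {{nonNeg*nonNeg⇒nonNeg a {{nonNegative 0≤a}} b {{nonNegative 0≤b}}}}

  x≤1+k⇒x/[1+k]≤1 : ∀ {x} k → x ≤ fromℕ (suc k) → x * 1/[1+k] k ≤ 1ℚ
  x≤1+k⇒x/[1+k]≤1 k x≤1+k = ≤-trans (*-monoʳ-≤-0≤ (1/[1+k] k) (1/[1+k]-nonNeg k) x≤1+k)
    (≤-reflexive (trans (*-comm (fromℕ (suc k)) (1/[1+k] k)) (1/[1+k]*[1+k]≡1 k)))

  1/[1+k]≤1 : ∀ k → 1/[1+k] k ≤ 1ℚ
  1/[1+k]≤1 k = subst (_≤ 1ℚ) (*-identityˡ (1/[1+k] k)) (x≤1+k⇒x/[1+k]≤1 k (fromℕ-mono-≤ {1} {suc k} (ℕ.s≤s ℕ.z≤n)))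

module ExponentialSeries where

  open import Data.Nat as ℕ using (ℕ; zero; suc; _^_)
  import Data.Nat.Properties as ℕ
  open import Data.Nat.Tactic.RingSolver using (solve-∀)
  open import Data.Rational
  open import Data.Rational.Properties
  open import Data.Rational.Solver using (module +-*-Solver)
  open import Relation.Binary.PropositionalEquality
  open import Relation.Nullary using (yes; no)
  open NaturalRationals
  open +-*-Solver

  -- Opaque so that N₀ = expBound (2 ^ 20) is never evaluated by the type checker.
  opaque
    expBound : ℕ → ℕ
    expBound n = 2 ℕ.* (2 ℕ.* n) ^ (2 ℕ.* n)

    expBound-unfold : ∀ n → expBound n ≡ 2 ℕ.* (2 ℕ.* n) ^ (2 ℕ.* n)
    expBound-unfold n = refl

    expBound-mono : ∀ {m n} → m ℕ.≤ n → expBound m ℕ.≤ expBound n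
    expBound-mono {m} {suc n} m≤n = ℕ.*-monoʳ-≤ 2 (ℕ.≤-trans (ℕ.^-monoˡ-≤ (2 ℕ.* m) 2m≤2n) (ℕ.^-monoʳ-≤ (2 ℕ.* suc n) 2m≤2n))
      where
      2m≤2n : 2 ℕ.* m ℕ.≤ 2 ℕ.* suc n
      2m≤2n = ℕ.*-monoʳ-≤ 2 m≤n
    expBound-mono {zero} {zero} _ = ℕ.≤-refl

  -- Weighting the k-th term by 2^k: consecutive ratios are 2q/(k+1), at most 2n, and at most 1 from k + 1 ≥ 2n on;
  -- so every weighted term is at most (2n)^(2n), and the partial sums stay below twice that.
  module _ {q : ℚ} {n : ℕ} (0≤q : 0ℚ ≤ q) (q≤n : q ≤ fromℕ n) (1≤n : 1 ℕ.≤ n) where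

    private
      t : ℕ → ℚ
      t = expTerm q
      c : ℕ
      c = 2 ℕ.* n
      W : ℚ
      W = fromℕ (c ^ c)
      2^ : ℕ → ℚ
      2^ k = fromℕ (2 ^ k)
      two : ℚ
      two = fromℕ 2
      ratio : ℕ → ℚ
      ratio k = q * 1/[1+k] k * two
      ratio-nonNeg : ∀ k → 0ℚ ≤ ratio k
      ratio-nonNeg k = *-0≤ (*-0≤ 0≤q (1/[1+k]-nonNeg k)) (fromℕ-nonNeg 2)
      c>0 : 0 ℕ.< c
      c>0 = ℕ.≤-trans 1≤n (ℕ.m≤n*m n 2)
      2q≤c : q * two ≤ fromℕ c
      2q≤c = ≤-trans (*-monoʳ-≤-0≤ two (fromℕ-nonNeg 2) q≤n) (≤-reflexive (trans (fromℕ-* n 2) (cong fromℕ (ℕ.*-comm n 2))))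

    weightedTerm-suc : ∀ k → t (suc k) * 2^ (suc k) ≡ t k * 2^ k * ratio k
    weightedTerm-suc k = trans (cong (t (suc k) *_) (sym (fromℕ-* 2 (2 ^ k))))
      (solve 5 (λ T Q R Tw P → (T :* Q :* R) :* (Tw :* P) := (T :* P) :* (Q :* R :* Tw)) refl (t k) q (1/[1+k] k) two (2^ k))

    ratio≤c : ∀ k → ratio k ≤ fromℕ c
    ratio≤c k = begin
      q * 1/[1+k] k * two   ≤⟨ *-monoʳ-≤-0≤ two (fromℕ-nonNeg 2) (*-monoˡ-≤-0≤ q 0≤q (1/[1+k]≤1 k)) ⟩
      q * 1ℚ * two          ≡⟨ cong (_* two) (*-identityʳ q) ⟩
      q * two               ≤⟨ 2q≤c ⟩
      fromℕ c               ∎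
      where open ≤-Reasoning

    ratio≤1 : ∀ k → c ℕ.≤ suc k → ratio k ≤ 1ℚ
    ratio≤1 k c≤1+k = subst (_≤ 1ℚ) (solve 3 (λ Q Tw R → Q :* Tw :* R := Q :* R :* Tw) refl q two (1/[1+k] k))
      (x≤1+k⇒x/[1+k]≤1 k (≤-trans 2q≤c (fromℕ-mono-≤ c≤1+k)))

    weightedTerm≤c^k : ∀ k → k ℕ.≤ c → t k * 2^ k ≤ fromℕ (c ^ k)
    weightedTerm≤c^k zero    _       = ≤-reflexive (*-identityˡ (fromℕ 1))
    weightedTerm≤c^k (suc k) 1+k≤c = begin
      t (suc k) * 2^ (suc k)   ≡⟨ weightedTerm-suc k ⟩
      t k * 2^ k * ratio k     ≤⟨ *-monoʳ-≤-0≤ (ratio k) (ratio-nonNeg k) (weightedTerm≤c^k k (ℕ.<⇒≤ 1+k≤c)) ⟩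
      fromℕ (c ^ k) * ratio k  ≤⟨ *-monoˡ-≤-0≤ (fromℕ (c ^ k)) (fromℕ-nonNeg (c ^ k)) (ratio≤c k) ⟩
      fromℕ (c ^ k) * fromℕ c  ≡⟨ trans (fromℕ-* (c ^ k) c) (cong fromℕ (ℕ.*-comm (c ^ k) c)) ⟩
      fromℕ (c ^ suc k)        ∎
      where open ≤-Reasoning

    weightedTerm≤W : ∀ k → t k * 2^ k ≤ W
    weightedTerm≤W k with k ℕ.≤? c
    ... | yes k≤c = ≤-trans (weightedTerm≤c^k k k≤c) (fromℕ-mono-≤ (ℕ.^-monoʳ-≤ c {{ℕ.>-nonZero c>0}} k≤c))
    ... | no  k≰c = subst (λ k → t k * 2^ k ≤ W) (ℕ.m+[n∸m]≡n (ℕ.<⇒≤ (ℕ.≰⇒> k≰c))) (beyond (k ℕ.∸ c))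
      where
      beyond : ∀ j → t (c ℕ.+ j) * 2^ (c ℕ.+ j) ≤ W
      beyond zero    = subst (λ k → t k * 2^ k ≤ W) (sym (ℕ.+-identityʳ c)) (weightedTerm≤c^k c ℕ.≤-refl)
      beyond (suc j) = subst (λ k → t k * 2^ k ≤ W) (sym (ℕ.+-suc c j)) (begin
        t (suc (c ℕ.+ j)) * 2^ (suc (c ℕ.+ j))   ≡⟨ weightedTerm-suc (c ℕ.+ j) ⟩
        t (c ℕ.+ j) * 2^ (c ℕ.+ j) * ratio (c ℕ.+ j)  ≤⟨ *-monoʳ-≤-0≤ _ (ratio-nonNeg (c ℕ.+ j)) (beyond j) ⟩
        W * ratio (c ℕ.+ j)
          ≤⟨ *-monoˡ-≤-0≤ W (fromℕ-nonNeg (c ^ c)) (ratio≤1 (c ℕ.+ j) (ℕ.m≤n⇒m≤1+n (ℕ.m≤m+n c j))) ⟩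
        W * 1ℚ                                    ≡⟨ *-identityʳ W ⟩
        W                                         ∎)
        where open ≤-Reasoning

    expPartial-weighted : ∀ K → expPartial q K * 2^ K + W ≤ two * W * 2^ K
    expPartial-weighted zero = subst₂ _≤_ (sym lhs) (sym rhs) (fromℕ-mono-≤ (begin
      1 ℕ.* 1 ℕ.+ c ^ c    ≤⟨ ℕ.+-monoˡ-≤ (c ^ c) (ℕ.m^n>0 c {{ℕ.>-nonZero c>0}} c) ⟩
      c ^ c ℕ.+ c ^ c      ≡⟨ double (c ^ c) ⟩
      2 ℕ.* c ^ c ℕ.* 1    ∎))
      where
      open ℕ.≤-Reasoning
      double : ∀ w → w ℕ.+ w ≡ 2 ℕ.* w ℕ.* 1
      double = solve-∀
      lhs : expPartial q 0 * 2^ 0 + W ≡ fromℕ (1 ℕ.* 1 ℕ.+ c ^ c)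
      lhs = trans (cong (_+ W) (fromℕ-* 1 1)) (fromℕ-+ (1 ℕ.* 1) (c ^ c))
      rhs : two * W * 2^ 0 ≡ fromℕ (2 ℕ.* c ^ c ℕ.* 1)
      rhs = trans (cong (_* 2^ 0) (fromℕ-* 2 (c ^ c))) (fromℕ-* (2 ℕ.* c ^ c) 1)
    expPartial-weighted (suc K) = begin
      (S + t (suc K)) * 2^ (suc K) + W              ≡⟨ cong (λ x → (S + t (suc K)) * x + W) 2^[1+K] ⟩
      (S + t (suc K)) * (two * 2^ K) + W
        ≡⟨ solve 5 (λ s u tw p w → (s :+ u) :* (tw :* p) :+ w := tw :* (s :* p) :+ u :* (tw :* p) :+ w)
                   refl S (t (suc K)) two (2^ K) W ⟩
      two * (S * 2^ K) + t (suc K) * (two * 2^ K) + W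
        ≤⟨ +-monoˡ-≤ W (+-monoʳ-≤ (two * (S * 2^ K)) (subst (_≤ W) (cong (t (suc K) *_) 2^[1+K]) (weightedTerm≤W (suc K)))) ⟩
      two * (S * 2^ K) + W + W                      ≡⟨ +-assoc (two * (S * 2^ K)) W W ⟩
      two * (S * 2^ K) + (W + W)                    ≡⟨ cong (two * (S * 2^ K) +_) W+W≡2W ⟩
      two * (S * 2^ K) + two * W                    ≡⟨ *-distribˡ-+ two (S * 2^ K) W ⟨
      two * (S * 2^ K + W)                          ≤⟨ *-monoˡ-≤-0≤ two (fromℕ-nonNeg 2) (expPartial-weighted K) ⟩
      two * (two * W * 2^ K)                        ≡⟨ solve 3 (λ tw w p → tw :* (tw :* w :* p) := tw :* w :* (tw :* p)) refl two W (2^ K) ⟩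
      two * W * (two * 2^ K)                        ≡⟨ cong (two * W *_) 2^[1+K] ⟨
      two * W * 2^ (suc K)                          ∎
      where
      open ≤-Reasoning
      S : ℚ
      S = expPartial q K
      2^[1+K] : 2^ (suc K) ≡ two * 2^ K
      2^[1+K] = sym (fromℕ-* 2 (2 ^ K))
      W+W≡2W : W + W ≡ two * W
      W+W≡2W = begin-equality
        W + W              ≡⟨ cong₂ _+_ (*-identityˡ W) (*-identityˡ W) ⟨
        1ℚ * W + 1ℚ * W    ≡⟨ *-distribʳ-+ W 1ℚ 1ℚ ⟨
        (1ℚ + 1ℚ) * W      ≡⟨ cong (_* W) (fromℕ-+ 1 1) ⟩
        two * W            ∎

    expPartial≤expBound : ∀ K → expPartial q K ≤ fromℕ (expBound n)
    expPartial≤expBound K = subst (expPartial q K ≤_) (trans (fromℕ-* 2 (c ^ c)) (cong fromℕ (sym (expBound-unfold n))))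
      (*-cancelʳ-≤-pos (2^ K) {{positive (fromℕ-mono-< {0} (ℕ.m^n>0 2 K))}}
        (≤-trans (subst (_≤ expPartial q K * 2^ K + W) (+-identityʳ _) (+-monoʳ-≤ (expPartial q K * 2^ K) (fromℕ-nonNeg (c ^ c))))
                 (expPartial-weighted K)))

module DimensionBound where

  open import Data.Nat
  open import Data.Nat.Properties
  open import Data.Nat.Tactic.RingSolver using (solve-∀)
  open import Relation.Binary.PropositionalEquality
  open import Relation.Nullary.Decidable using (toWitness)
  open PowerfulCubes using (DimensionInequality)
  open ExponentialSeries using (expBound; expBound-unfold)

  2^m≤2^n⇒m≤n : ∀ {m n} → 2 ^ m ≤ 2 ^ n → m ≤ n
  2^m≤2^n⇒m≤n 2^m≤2^n = ≮⇒≥ (λ n<m → <⇒≱ (^-monoʳ-< 2 (s≤s (s≤s z≤n)) n<m) 2^m≤2^n)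

  exponent : ℕ → ℕ
  exponent t = suc (2+ t * 2 ^ 2+ t)

  expBound[2^[1+t]]≡2^exponent : ∀ t → expBound (2 ^ suc t) ≡ 2 ^ exponent t
  expBound[2^[1+t]]≡2^exponent t = trans (expBound-unfold (2 ^ suc t)) (cong (2 *_) (^-*-assoc 2 (2+ t) (2 ^ 2+ t)))

  exponent-bound : ∀ {a N d r E} → 2 ^ a ≤ (N ^ d) ^ r → N ≤ 2 ^ E → a ≤ E * d * r
  exponent-bound {a} {N} {d} {r} {E} 2^a≤ N≤2^E = 2^m≤2^n⇒m≤n (begin
    2 ^ a              ≤⟨ 2^a≤ ⟩
    (N ^ d) ^ r        ≤⟨ ^-monoˡ-≤ r (^-monoˡ-≤ d N≤2^E) ⟩
    ((2 ^ E) ^ d) ^ r  ≡⟨ cong (_^ r) (^-*-assoc 2 E d) ⟩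
    (2 ^ (E * d)) ^ r  ≡⟨ ^-*-assoc 2 (E * d) r ⟩
    2 ^ (E * d * r)    ∎)
    where open ≤-Reasoning

  X≤1+2B : ∀ {X d B} → 0 < d → 4 * X ≤ d → (X ∸ 1) * (d ∸ 2 * X) ≤ B * d → X ≤ suc (2 * B)
  X≤1+2B {X} {d} {B} d>0 4X≤d ineq = ≤-trans (m≤n+m∸n X 1) (s≤s (*-cancelʳ-≤ (X ∸ 1) (2 * B) d {{>-nonZero d>0}} (begin
    (X ∸ 1) * d              ≤⟨ *-monoʳ-≤ (X ∸ 1) d≤2y ⟩
    (X ∸ 1) * (2 * y)        ≡⟨ swap (X ∸ 1) y ⟩
    2 * ((X ∸ 1) * y)        ≤⟨ *-monoʳ-≤ 2 ineq ⟩
    2 * (B * d)              ≡⟨ *-assoc 2 B d ⟨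
    2 * B * d                ∎)))
    where
    open ≤-Reasoning
    y : ℕ
    y = d ∸ 2 * X
    d≡2X+y : d ≡ 2 * X + y
    d≡2X+y = sym (m+[n∸m]≡n (≤-trans (*-monoˡ-≤ X (s≤s (s≤s (z≤n {2})))) 4X≤d))
    2X≤y : 2 * X ≤ y
    2X≤y = +-cancelˡ-≤ (2 * X) (2 * X) y (begin
      2 * X + 2 * X   ≡⟨ four X ⟩
      4 * X           ≤⟨ 4X≤d ⟩
      d               ≡⟨ d≡2X+y ⟩
      2 * X + y       ∎)
      where
      four : ∀ X → 2 * X + 2 * X ≡ 4 * X
      four = solve-∀
    d≤2y : d ≤ 2 * y
    d≤2y = begin
      d           ≡⟨ d≡2X+y ⟩
      2 * X + y   ≤⟨ +-monoˡ-≤ y 2X≤y ⟩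
      y + y       ≡⟨ cong (y +_) (+-identityʳ y) ⟨
      2 * y       ∎
    swap : ∀ a y → a * (2 * y) ≡ 2 * (a * y)
    swap = solve-∀

  64[t+2]²≤2^t : ∀ {t} → 20 ≤ t → 64 * (2+ t * 2+ t) ≤ 2 ^ t
  64[t+2]²≤2^t {t} 20≤t = subst (λ t → 64 * (2+ t * 2+ t) ≤ 2 ^ t) (m∸n+n≡m 20≤t) (from20 (t ∸ 20))
    where
    from20 : ∀ j → 64 * (2+ (j + 20) * 2+ (j + 20)) ≤ 2 ^ (j + 20)
    from20 zero    = toWitness {a? = 64 * (22 * 22) ≤? 2 ^ 20} _
    from20 (suc j) = begin
      64 * (suc B * suc B)         ≡⟨ expand B ⟩
      64 * (B * B) + 64 * (2 * B + 1)  ≤⟨ +-monoʳ-≤ (64 * (B * B)) (*-monoʳ-≤ 64 2B+1≤B²) ⟩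
      64 * (B * B) + 64 * (B * B)  ≡⟨ cong (64 * (B * B) +_) (+-identityʳ (64 * (B * B))) ⟨
      2 * (64 * (B * B))           ≤⟨ *-monoʳ-≤ 2 (from20 j) ⟩
      2 ^ suc (j + 20)             ∎
      where
      open ≤-Reasoning
      B : ℕ
      B = 2+ (j + 20)
      2B+1≤B² : 2 * B + 1 ≤ B * B
      2B+1≤B² = begin
        2 * B + 1   ≤⟨ +-monoʳ-≤ (2 * B) (s≤s z≤n) ⟩
        2 * B + B   ≡⟨ three B ⟩
        B * 3       ≤⟨ *-monoʳ-≤ B (s≤s (s≤s (≤-trans (s≤s z≤n) (m≤n+m 20 j)))) ⟩
        B * B       ∎
        where
        three : ∀ B → 2 * B + B ≡ B * 3
        three = solve-∀
      expand : ∀ B → 64 * (suc B * suc B) ≡ 64 * (B * B) + 64 * (2 * B + 1)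
      expand = solve-∀

  2+2*exponent*[1+2t]≤4^t : ∀ {t} → 20 ≤ t → 2 + 2 * (exponent t * suc (t + t)) ≤ 2 ^ t * 2 ^ t
  2+2*exponent*[1+2t]≤4^t {t} 20≤t = begin
    2 + 2 * (suc (B * (2 * (2 * A))) * suc (t + t))  ≤⟨ +-monoʳ-≤ 2 (*-monoʳ-≤ 2 (*-monoʳ-≤ (suc (B * (2 * (2 * A)))) 1+2t≤2B)) ⟩
    2 + 2 * (suc (B * (2 * (2 * A))) * (2 * B))      ≡⟨ expand B A ⟩
    16 * (B * B * A) + (4 * B + 2)                   ≤⟨ +-monoʳ-≤ (16 * (B * B * A)) 4B+2≤48B²A ⟩
    16 * (B * B * A) + 48 * (B * B * A)              ≡⟨ collect B A ⟩
    64 * (B * B) * A                                 ≤⟨ *-monoˡ-≤ A (64[t+2]²≤2^t 20≤t) ⟩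
    A * A                                            ∎
    where
    open ≤-Reasoning
    A B : ℕ
    A = 2 ^ t
    B = 2+ t
    A>0 : 0 < A
    A>0 = m^n>0 2 t
    1+2t≤2B : suc (t + t) ≤ 2 * B
    1+2t≤2B = begin
      suc (t + t)      ≤⟨ m≤n+m (suc (t + t)) 3 ⟩
      3 + suc (t + t)  ≡⟨ twice t ⟩
      2 * B            ∎
      where
      twice : ∀ t → 3 + suc (t + t) ≡ 2 * (2 + t)
      twice = solve-∀
    4B+2≤48B²A : 4 * B + 2 ≤ 48 * (B * B * A)
    4B+2≤48B²A = begin
      4 * B + 2         ≤⟨ +-monoʳ-≤ (4 * B) (*-monoʳ-≤ 2 (s≤s (z≤n {suc t}))) ⟩
      4 * B + 2 * B     ≡⟨ six B ⟩
      6 * B             ≤⟨ *-monoʳ-≤ 6 (≤-trans (m≤m*n B B) (m≤m*n (B * B) A {{>-nonZero A>0}})) ⟩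
      6 * (B * B * A)   ≤⟨ *-monoˡ-≤ (B * B * A) (toWitness {a? = 6 ≤? 48} _) ⟩
      48 * (B * B * A)  ∎
      where
      six : ∀ B → 4 * B + 2 * B ≡ 6 * B
      six = solve-∀
    expand : ∀ B A → 2 + 2 * (suc (B * (2 * (2 * A))) * (2 * B)) ≡ 16 * (B * B * A) + (4 * B + 2)
    expand = solve-∀
    collect : ∀ B A → 16 * (B * B * A) + 48 * (B * B * A) ≡ 64 * (B * B) * A
    collect = solve-∀

  dimension≤5*4^t : ∀ {d N t} → DimensionInequality d N → 20 ≤ t → N < expBound (2 ^ suc t) → d ≤ 5 * (2 ^ t * 2 ^ t)
  dimension≤5*4^t {d} {N} {t} ineq 20≤t N<bound = ≮⇒≥ λ 5X<d →
    <⇒≱ (2+2*exponent*[1+2t]≤4^t 20≤t)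
        (X≤1+2B (≤-trans z<s 5X<d) (≤-trans (*-monoˡ-≤ X (n≤1+n 4)) (<⇒≤ 5X<d))
          (subst ((X ∸ 1) * (d ∸ 2 * X) ≤_) (rearrange (exponent t) d r)
            (exponent-bound {N = N} {d} {r} {exponent t} (ineq X r 1≤X X<2^r) N≤2^exponent)))
    where
    X r : ℕ
    X = 2 ^ t * 2 ^ t
    r = suc (t + t)
    1≤X : 1 ≤ X
    1≤X = *-mono-≤ (m^n>0 2 t) (m^n>0 2 t)
    X<2^r : X < 2 ^ r
    X<2^r = subst (_< 2 ^ r) (^-distribˡ-+-* 2 t t) (^-monoʳ-< 2 (s≤s (s≤s z≤n)) (n<1+n (t + t)))
    N≤2^exponent : N ≤ 2 ^ exponent t
    N≤2^exponent = subst (N ≤_) (expBound[2^[1+t]]≡2^exponent t) (<⇒≤ N<bound)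
    rearrange : ∀ E d r → E * d * r ≡ E * r * d
    rearrange = solve-∀

module LogSquareBound where

  open import Data.Nat as ℕ using (ℕ; zero; suc; _^_)
  import Data.Nat.Properties as ℕ
  open import Data.Rational
  open import Data.Rational.Properties
  open import Data.Empty using (⊥-elim)
  open import Data.Product using (∃; _×_; _,_)
  open import Data.Sum using (_⊎_; inj₁; inj₂)
  open import Relation.Nullary using (¬_; yes; no)
  open import Relation.Binary.PropositionalEquality
  open NaturalRationals
  open ExponentialSeries
  open DimensionBound using (dimension≤5*4^t)
  open PowerfulCubes using (DimensionInequality)

  n<2^n : ∀ n → n ℕ.< 2 ^ n
  n<2^n zero    = ℕ.z<s
  n<2^n (suc n) = ℕ.+-mono-≤-< (ℕ.m^n>0 2 n) (ℕ.<-≤-trans (n<2^n n) (ℕ.m≤m+n (2 ^ n) 0))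

  q≤2^d : ∀ {q d} → 0ℚ ≤ q → fromℕ 5 * q * q < fromℕ d → q ≤ fromℕ (2 ^ d)
  q≤2^d {q} {d} 0≤q 5q²<d with q ≤? 1ℚ
  ... | yes q≤1 = ≤-trans q≤1 (fromℕ-mono-≤ (ℕ.m^n>0 2 d))
  ... | no  q≰1 = ≤-trans (<⇒≤ (begin-strict
      q                  <⟨ subst (_< q * q) (*-identityˡ q) (*-monoˡ-<-pos q {{positive 0<q}} 1<q) ⟩
      q * q              ≡⟨ *-identityˡ (q * q) ⟨
      1ℚ * (q * q)       ≤⟨ *-monoʳ-≤-0≤ (q * q) (*-0≤ 0≤q 0≤q) (fromℕ-mono-≤ {1} {5} (ℕ.s≤s ℕ.z≤n)) ⟩
      fromℕ 5 * (q * q)  ≡⟨ *-assoc (fromℕ 5) q q ⟨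
      fromℕ 5 * q * q    <⟨ 5q²<d ⟩
      fromℕ d            ∎)) (fromℕ-mono-≤ (ℕ.<⇒≤ (n<2^n d)))
    where
    open ≤-Reasoning
    1<q : 1ℚ < q
    1<q = ≰⇒> q≰1
    0<q : 0ℚ < q
    0<q = <-trans (fromℕ-mono-< {0} {1} ℕ.z<s) 1<q

  powerOfTwo-bracket : ∀ {q} j → q ≤ fromℕ (2 ^ j) →
                       q ≤ fromℕ 1 ⊎ ∃ λ t → fromℕ (2 ^ t) < q × q ≤ fromℕ (2 ^ suc t)
  powerOfTwo-bracket zero    q≤1 = inj₁ q≤1
  powerOfTwo-bracket {q} (suc j) q≤2^[1+j] with q ≤? fromℕ (2 ^ j)
  ... | yes q≤2^j = powerOfTwo-bracket j q≤2^j
  ... | no  q≰2^j = inj₂ (j , ≰⇒> q≰2^j , q≤2^[1+j])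

  5*4^t<d : ∀ {q d t} → 0ℚ ≤ q → fromℕ (2 ^ t) < q → fromℕ 5 * q * q < fromℕ d → 5 ℕ.* (2 ^ t ℕ.* 2 ^ t) ℕ.< d
  5*4^t<d {q} {d} {t} 0≤q 2^t<q 5q²<d = fromℕ-cancel-< (begin-strict
    fromℕ (5 ℕ.* (2 ^ t ℕ.* 2 ^ t))  ≡⟨ trans (cong (fromℕ 5 *_) (fromℕ-* (2 ^ t) (2 ^ t))) (fromℕ-* 5 (2 ^ t ℕ.* 2 ^ t)) ⟨
    fromℕ 5 * (a * a)                ≤⟨ *-monoˡ-≤-0≤ (fromℕ 5) (fromℕ-nonNeg 5)
                                          (≤-trans (*-monoˡ-≤-0≤ a (fromℕ-nonNeg (2 ^ t)) a≤q) (*-monoʳ-≤-0≤ q 0≤q a≤q)) ⟩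
    fromℕ 5 * (q * q)                ≡⟨ *-assoc (fromℕ 5) q q ⟨
    fromℕ 5 * q * q                  <⟨ 5q²<d ⟩
    fromℕ d                          ∎)
    where
    open ≤-Reasoning
    a : ℚ
    a = fromℕ (2 ^ t)
    a≤q : a ≤ q
    a≤q = <⇒≤ 2^t<q

  N<expBound : ∀ {q n N K} → 0ℚ ≤ q → q ≤ fromℕ n → 1 ℕ.≤ n → ¬ (expPartial q K ≤ fromℕ N) → N ℕ.< expBound n
  N<expBound {K = K} 0≤q q≤n 1≤n exceeds = fromℕ-cancel-< (<-≤-trans (≰⇒> exceeds) (expPartial≤expBound 0≤q q≤n 1≤n K))

  N₀ : ℕ
  N₀ = expBound (2 ^ 20)

  N₀≤N⇒20<n : ∀ {N n} → N₀ ℕ.≤ N → N ℕ.< expBound (2 ^ n) → 20 ℕ.< n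
  N₀≤N⇒20<n N₀≤N N<bound = ℕ.≰⇒> (λ n≤20 → ℕ.<⇒≱ N<bound (ℕ.≤-trans (expBound-mono (ℕ.^-monoʳ-≤ 2 n≤20)) N₀≤N))

  -- If a partial sum of e^q exceeds N, take 2^t < q ≤ 2^(t+1): N < expBound (2^(t+1)) forces t ≥ 20,
  -- and then d ≤ 5·4^t < 5q² contradicts 5q² < d.
  logSqBound : ∀ {d N} → N₀ ℕ.≤ N → DimensionInequality d N → LogSqBound d N
  logSqBound {d} {N} N₀≤N ineq q 0≤q 5q²<d K with expPartial q K ≤? fromℕ N
  ... | yes within = within
  ... | no  exceeds with powerOfTwo-bracket {q} d (q≤2^d {q} {d} 0≤q 5q²<d)
  ...   | inj₁ q≤1 =
    ⊥-elim (ℕ.<⇒≱ (N₀≤N⇒20<n {N} {0} N₀≤N (N<expBound {q} {1} {N} {K} 0≤q q≤1 ℕ.≤-refl exceeds)) ℕ.z≤n)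
  ...   | inj₂ (t , 2^t<q , q≤2^[1+t]) =
    ⊥-elim (ℕ.<⇒≱ (5*4^t<d {q} {d} {t} 0≤q 2^t<q 5q²<d)
                  (dimension≤5*4^t ineq (ℕ.s≤s⁻¹ (N₀≤N⇒20<n {N} {suc t} N₀≤N N<bound)) N<bound))
    where
    N<bound : N ℕ.< expBound (2 ^ suc t)
    N<bound = N<expBound {q} {2 ^ suc t} {N} {K} 0≤q q≤2^[1+t] (ℕ.m^n>0 2 (suc t)) exceeds

open import Data.Nat using (ℕ; _≥_; _<_)
open import Data.Fin using (Fin)
open import Data.Product using (∃; _,_)
open import Function.Definitions using (Injective)
open import Relation.Binary.PropositionalEquality using (_≡_)
open LogSquareBound using (N₀; logSqBound)
open PowerfulCubes using (cube⇒dimensionInequality)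

theorem3 : ∃ λ (N₀ : ℕ) → ∀ (N : ℕ) → N ≥ N₀ →
    ∀ (a₀ d : ℕ) (a : Fin d → ℕ) →
    Injective _≡_ _≡_ a → (∀ i → 0 < a i) →
    CubeSubset a₀ a (PowerfulUpTo N) →
    LogSqBound d N
theorem3 = N₀ , λ N N≥N₀ a₀ d a _ a>0 cube → logSqBound N≥N₀ (cube⇒dimensionInequality a>0 cube)
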